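{- Let $G$ be a minimal counterexample (as defined in the context). Then $G$ has no two adjacent vertices of degree $2$.
   Context: All graphs are finite and simple. A 2-distance coloring of $G$ is a vertex coloring in which any two distinct vertices at distance at most $2$ receive different colors. A minimal counterexample is a planar graph $G$ with girth at least $6$ and maximum degree $\Delta=\Delta(G)\geq 6$ which admits no 2-distance coloring with $\Delta+4$ colors, and which has the minimum number of vertices among all planar graphs with girth at least $6$ and maximum degree at least $6$ admitting no 2-distance coloring with (their maximum degree)$+4$ colors. $d(v)$ denotes the degree of $v$; a $k$-vertex is a vertex of degree $k$. -}

module Defs where

open import Data.Nat as ℕ using (ℕ; zero; suc; _⊔_)
open import Data.Bool using (Bool; true; false)
open import Data.Fin using (Fin; zero; suc; inject₁; fromℕ)
open import Data.List using (List; length; filterᵇ; map; foldr; allFin)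
open import Data.Product using (Σ; ∃; ∃-syntax; _×_; _,_; proj₁; proj₂)
open import Data.Sum using (_⊎_)
open import Data.Rational using (ℚ; 0ℚ; 1ℚ; _+_; _*_; _-_; _≤_)
open import Relation.Binary.PropositionalEquality using (_≡_; _≢_)
open import Relation.Nullary using (¬_)
open import Function.Definitions using (Injective)

record Graph : Set where
  field
    n     : ℕ
    adj   : Fin n → Fin n → Bool
    sym   : ∀ u v → adj u v ≡ adj v u
    irrfl : ∀ v → adj v v ≡ false
open Graph public

deg : (G : Graph) → Fin (n G) → ℕ
deg G v = length (filterᵇ (adj G v) (allFin (n G)))

-- maximum degree (0 for the empty graph)
Δ : Graph → ℕ
Δ G = foldr _⊔_ 0 (map (deg G) (allFin (n G)))

Adjacent : (G : Graph) → Fin (n G) → Fin (n G) → Set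
Adjacent G u v = adj G u v ≡ true

-- A cycle of length (suc m) (m ≥ 2): distinct vertices f 0, …, f m with
-- f i ~ f (i+1) and f m ~ f 0.
Cycle : (G : Graph) → ℕ → Set
Cycle G m =
  Σ (Fin (suc m) → Fin (n G)) λ f →
    Injective _≡_ _≡_ f ×
    (∀ (i : Fin m) → Adjacent G (f (inject₁ i)) (f (suc i))) ×
    Adjacent G (f (fromℕ m)) (f zero)

-- girth at least 6: no cycles of length 3, 4 or 5
GirthAtLeast6 : Graph → Set
GirthAtLeast6 G = ∀ m → 2 ℕ.≤ m → m ℕ.≤ 4 → ¬ Cycle G m

WithinDist2 : (G : Graph) → Fin (n G) → Fin (n G) → Set
WithinDist2 G u v = Adjacent G u v ⊎ (∃[ w ] (Adjacent G u w × Adjacent G w v))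

TwoDistColoring : (G : Graph) → ℕ → Set
TwoDistColoring G k =
  Σ (Fin (n G) → Fin k) λ c →
    ∀ u v → u ≢ v → WithinDist2 G u v → c u ≢ c v

-- Planarity, via straight-line embeddings with rational coordinates
-- (equivalent to planarity by Fáry's theorem plus perturbation).

Point : Set
Point = ℚ × ℚ

OnSeg : Point → Point → Point → Set
OnSeg q a b = ∃[ t ] (0ℚ ≤ t × t ≤ 1ℚ ×
  proj₁ q ≡ proj₁ a + t * (proj₁ b - proj₁ a) ×
  proj₂ q ≡ proj₂ a + t * (proj₂ b - proj₂ a))

Planar : Graph → Set
Planar G =
  Σ (Fin (n G) → Point) λ p →
    Injective _≡_ _≡_ p ×
    (∀ w a b → Adjacent G a b → w ≢ a → w ≢ b → ¬ OnSeg (p w) (p a) (p b)) ×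
    (∀ a b c d → Adjacent G a b → Adjacent G c d →
       ¬ ((a ≡ c × b ≡ d) ⊎ (a ≡ d × b ≡ c)) →
       ∀ q → OnSeg q (p a) (p b) → OnSeg q (p c) (p d) →
       ∃[ w ] ((w ≡ a ⊎ w ≡ b) × (w ≡ c ⊎ w ≡ d) × q ≡ p w))

IsCounterexample : Graph → Set
IsCounterexample G =
  Planar G × GirthAtLeast6 G × 6 ℕ.≤ Δ G × ¬ TwoDistColoring G (Δ G ℕ.+ 4)

MinimalCounterexample : Graph → Set
MinimalCounterexample G =
  IsCounterexample G × (∀ H → IsCounterexample H → n G ℕ.≤ n H)

{-# OPTIONS --safe #-}
-- Let uv be an edge joining two 2-vertices and w a vertex of maximum degree. If w is not
-- adjacent to u, then G - u is a smaller counterexample: it keeps w's degree, hence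
-- Δ(G - u) ≥ 6, and any 2-distance colouring of G - u with Δ(G - u) + 4 ≤ Δ + 4 colours extends
-- to G by recolouring v (it sees at most 2 + Δ coloured vertices) and then colouring u (it
-- sees at most 3 + Δ). So w is adjacent to both u and v, and uvw is a triangle.
module Submission where

open import Defs renaming (sym to adj-sym)
open import Data.Bool using (Bool; true; false; if_then_else_; T?)
open import Data.Bool.Properties using (T-≡)
open import Data.Empty using (⊥; ⊥-elim)
open import Data.Fin using (Fin; zero; suc; punchIn; punchOut; inject₁; inject≤; _≟_)
open import Data.Fin.Properties
  using (punchIn-injective; punchIn-punchOut; inject≤-injective; nonZeroIndex; pigeonhole; ¬∀⟶∃¬)
  renaming (<-irrefl to <-irreflᶠ)
open import Data.List using (List; []; _∷_; length; filterᵇ; map; allFin; tabulate; lookup)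
open import Data.List.Membership.Propositional using (_∈_; _∉_)
open import Data.List.Membership.Propositional.Properties
  using (∈-allFin; ∈-map⁺; ∈-map⁻; ∈-filter⁺; foldr-selective)
open import Data.List.Properties using (length-map; foldr-preservesᵇ; foldr-forcesᵇ)
import Data.List.Relation.Unary.All as All
open import Data.List.Relation.Unary.Any using (here; there; index; any?)
open import Data.List.Relation.Unary.Any.Properties using (lookup-index)
open import Data.Nat using (ℕ; zero; suc; pred; _+_; _⊔_; _≤_; _<_; z≤n; s≤s)
open import Data.Nat.Properties
  using (≤-refl; ≤-trans; ≤-reflexive; n≤1+n; <⇒≢; <⇒≱; suc-pred; +-comm; +-mono-≤; +-monoˡ-≤;
         ⊔-lub; ⊔-sel; m⊔n≤o⇒m≤o; m⊔n≤o⇒n≤o; module ≤-Reasoning)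
open import Data.Product using (∃-syntax; _×_; _,_; proj₁; proj₂)
import Data.Product as Product
import Data.Sum as Sum
open import Data.Sum using (_⊎_; inj₁; inj₂)
open import Data.Vec.Functional using (updateAt)
open import Data.Vec.Functional.Properties using (updateAt-updates; updateAt-minimal)
open import Function using (_∘_; id; const; Equivalence)
open import Function.Definitions using (Injective)
open import Relation.Binary.PropositionalEquality
open import Relation.Nullary using (¬_; yes; no)

countᵇ : ∀ {m} → (Fin m → Bool) → ℕ
countᵇ {m} p = length (filterᵇ p (allFin m))

sucIf : Bool → ℕ → ℕ
sucIf b = if b then suc else id

sucIf-comm : ∀ a b k → sucIf a (sucIf b k) ≡ sucIf b (sucIf a k)
sucIf-comm false b     k = refl
sucIf-comm true  false k = refl
sucIf-comm true  true  k = refl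

n≤sucIf : ∀ b k → k ≤ sucIf b k
n≤sucIf false k = ≤-refl
n≤sucIf true  k = n≤1+n k

length-filterᵇ-∷ : ∀ {A : Set} (p : A → Bool) x xs →
  length (filterᵇ p (x ∷ xs)) ≡ sucIf (p x) (length (filterᵇ p xs))
length-filterᵇ-∷ p x xs with p x
... | true  = refl
... | false = refl

length-filterᵇ-tabulate : ∀ {A : Set} {m} (p : A → Bool) (f : Fin m → A) →
  length (filterᵇ p (tabulate f)) ≡ countᵇ (p ∘ f)
length-filterᵇ-tabulate {m = zero}  p f = refl
length-filterᵇ-tabulate {m = suc m} p f = begin
  length (filterᵇ p (tabulate f))
    ≡⟨ length-filterᵇ-∷ p (f zero) _ ⟩
  sucIf (p (f zero)) (length (filterᵇ p (tabulate (f ∘ suc))))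
    ≡⟨ cong (sucIf (p (f zero))) (length-filterᵇ-tabulate p (f ∘ suc)) ⟩
  sucIf (p (f zero)) (countᵇ (p ∘ f ∘ suc))
    ≡⟨ cong (sucIf (p (f zero))) (length-filterᵇ-tabulate (p ∘ f) suc) ⟨
  sucIf (p (f zero)) (length (filterᵇ (p ∘ f) (tabulate suc)))
    ≡⟨ length-filterᵇ-∷ (p ∘ f) zero _ ⟨
  countᵇ (p ∘ f)
    ∎
  where open ≡-Reasoning

countᵇ-suc : ∀ {m} (p : Fin (suc m) → Bool) → countᵇ p ≡ sucIf (p zero) (countᵇ (p ∘ suc))
countᵇ-suc p =
  trans (length-filterᵇ-∷ p zero _) (cong (sucIf (p zero)) (length-filterᵇ-tabulate p suc))

-- punchIn and punchOut for a bound that is not syntactically a successor, such as n G.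
punchIn′ : ∀ {m} → Fin m → Fin (pred m) → Fin m
punchIn′ {suc _} = punchIn

punchOut′ : ∀ {m} {u z : Fin m} → u ≢ z → Fin (pred m)
punchOut′ {suc _} = punchOut

punchIn′-injective : ∀ {m} (u : Fin m) → Injective _≡_ _≡_ (punchIn′ u)
punchIn′-injective {suc _} u = punchIn-injective u _ _

punchIn′-punchOut′ : ∀ {m} {u z : Fin m} (u≢z : u ≢ z) → punchIn′ u (punchOut′ u≢z) ≡ z
punchIn′-punchOut′ {suc _} = punchIn-punchOut

pred[m]<m : ∀ {m} → Fin m → pred m < m
pred[m]<m u = ≤-reflexive (suc-pred _ {{nonZeroIndex u}})

countᵇ-punchIn′ : ∀ {m} (p : Fin m → Bool) u →
  countᵇ p ≡ sucIf (p u) (countᵇ (p ∘ punchIn′ u))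
countᵇ-punchIn′ {suc m}       p zero    = countᵇ-suc p
countᵇ-punchIn′ {suc (suc m)} p (suc u) = begin
  countᵇ p
    ≡⟨ countᵇ-suc p ⟩
  sucIf (p zero) (countᵇ (p ∘ suc))
    ≡⟨ cong (sucIf (p zero)) (countᵇ-punchIn′ (p ∘ suc) u) ⟩
  sucIf (p zero) (sucIf (p (suc u)) (countᵇ (p ∘ suc ∘ punchIn u)))
    ≡⟨ sucIf-comm (p zero) (p (suc u)) _ ⟩
  sucIf (p (suc u)) (sucIf (p zero) (countᵇ (p ∘ suc ∘ punchIn u)))
    ≡⟨ cong (sucIf (p (suc u))) (countᵇ-suc (p ∘ punchIn (suc u))) ⟨
  sucIf (p (suc u)) (countᵇ (p ∘ punchIn (suc u)))
    ∎
  where open ≡-Reasoning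

countᵇ-punchIn′-≤ : ∀ {m} (p : Fin m → Bool) u → countᵇ (p ∘ punchIn′ u) ≤ countᵇ p
countᵇ-punchIn′-≤ p u = ≤-trans (n≤sucIf (p u) _) (≤-reflexive (sym (countᵇ-punchIn′ p u)))

countᵇ-punchIn′-≡ : ∀ {m} (p : Fin m → Bool) {u} → p u ≡ false →
  countᵇ (p ∘ punchIn′ u) ≡ countᵇ p
countᵇ-punchIn′-≡ p {u} pu≡false =
  sym (trans (countᵇ-punchIn′ p u) (cong (λ b → sucIf b (countᵇ (p ∘ punchIn′ u))) pu≡false))

collapse : ∀ {m} {u d : Fin m} → u ≢ d → Fin m → Fin (pred m)
collapse {u = u} u≢d z with u ≟ z
... | yes _   = punchOut′ u≢d
... | no u≢z = punchOut′ u≢z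

punchIn′-collapse : ∀ {m} {u d z : Fin m} (u≢d : u ≢ d) → u ≢ z →
  punchIn′ u (collapse u≢d z) ≡ z
punchIn′-collapse {u = u} {z = z} u≢d u≢z with u ≟ z
... | yes u≡z  = ⊥-elim (u≢z u≡z)
... | no u≢z′ = punchIn′-punchOut′ u≢z′

length<⇒∃∉ : ∀ {k} (xs : List (Fin k)) → length xs < k → ∃[ i ] i ∉ xs
length<⇒∃∉ {k} xs |xs|<k = ¬∀⟶∃¬ k (_∈ xs) (λ i → any? (i ≟_) xs) not-all
  where
  not-all : ¬ (∀ i → i ∈ xs)
  not-all all∈ with i , j , i<j , same-index ← pigeonhole |xs|<k (index ∘ all∈) =
    <-irreflᶠ (begin
      i                          ≡⟨ lookup-index (all∈ i) ⟩
      lookup xs (index (all∈ i)) ≡⟨ cong (lookup xs) same-index ⟩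
      lookup xs (index (all∈ j)) ≡⟨ lookup-index (all∈ j) ⟨
      j                          ∎) i<j
    where open ≡-Reasoning

length≡2⇒other : ∀ {A : Set} {xs : List A} {v} → length xs ≡ 2 → v ∈ xs →
  ∃[ x ] ∀ {z} → z ∈ xs → z ≡ v ⊎ z ≡ x
length≡2⇒other {xs = a ∷ b ∷ []} refl (here refl) =
  b , λ { (here refl) → inj₁ refl ; (there (here refl)) → inj₂ refl }
length≡2⇒other {xs = a ∷ b ∷ []} refl (there (here refl)) =
  a , λ { (here refl) → inj₂ refl ; (there (here refl)) → inj₁ refl }

neighbours : (G : Graph) → Fin (n G) → List (Fin (n G))
neighbours G v = filterᵇ (adj G v) (allFin (n G))

module _ (G : Graph) where

  Adjacent-sym : ∀ {a b} → Adjacent G a b → Adjacent G b a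
  Adjacent-sym {a} {b} ab = trans (adj-sym G b a) ab

  Adjacent⇒≢ : ∀ {a b} → Adjacent G a b → a ≢ b
  Adjacent⇒≢ {a} aa refl with trans (sym aa) (irrfl G a)
  ... | ()

  WithinDist2-sym : ∀ {a b} → WithinDist2 G a b → WithinDist2 G b a
  WithinDist2-sym (inj₁ ab)            = inj₁ (Adjacent-sym ab)
  WithinDist2-sym (inj₂ (t , at , tb)) = inj₂ (t , Adjacent-sym tb , Adjacent-sym at)

  ∈-neighbours : ∀ {a b} → Adjacent G a b → b ∈ neighbours G a
  ∈-neighbours {a} {b} ab = ∈-filter⁺ (T? ∘ adj G a) (∈-allFin b) (Equivalence.from T-≡ ab)

  degree-2-neighbours : ∀ {u v} → deg G u ≡ 2 → Adjacent G u v →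
    ∃[ x ] ∀ {z} → Adjacent G u z → z ≡ v ⊎ z ≡ x
  degree-2-neighbours du uv with x , other ← length≡2⇒other du (∈-neighbours uv) =
    x , other ∘ ∈-neighbours

  no-triangle : GirthAtLeast6 G → ∀ {a b c} → Adjacent G a b → Adjacent G b c → Adjacent G c a → ⊥
  no-triangle girth {a} {b} {c} ab bc ca =
    girth 2 ≤-refl (s≤s (s≤s z≤n)) (vertex , vertex-injective , path , ca)
    where
    vertex : Fin 3 → Fin (n G)
    vertex zero             = a
    vertex (suc zero)       = b
    vertex (suc (suc zero)) = c

    path : ∀ (i : Fin 2) → Adjacent G (vertex (inject₁ i)) (vertex (suc i))
    path zero       = ab
    path (suc zero) = bc

    a≢b : a ≢ b
    a≢b = Adjacent⇒≢ ab
    b≢c : b ≢ c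
    b≢c = Adjacent⇒≢ bc
    c≢a : c ≢ a
    c≢a = Adjacent⇒≢ ca

    vertex-injective : Injective _≡_ _≡_ vertex
    vertex-injective {zero}             {zero}             _   = refl
    vertex-injective {zero}             {suc zero}         a≡b = ⊥-elim (a≢b a≡b)
    vertex-injective {zero}             {suc (suc zero)}   a≡c = ⊥-elim (c≢a (sym a≡c))
    vertex-injective {suc zero}         {zero}             b≡a = ⊥-elim (a≢b (sym b≡a))
    vertex-injective {suc zero}         {suc zero}         _   = refl
    vertex-injective {suc zero}         {suc (suc zero)}   b≡c = ⊥-elim (b≢c b≡c)
    vertex-injective {suc (suc zero)}   {zero}             c≡a = ⊥-elim (c≢a c≡a)
    vertex-injective {suc (suc zero)}   {suc zero}         c≡b = ⊥-elim (b≢c (sym c≡b))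
    vertex-injective {suc (suc zero)}   {suc (suc zero)}   _   = refl

deg≤Δ : (G : Graph) (v : Fin (n G)) → deg G v ≤ Δ G
deg≤Δ G v =
  All.lookup (foldr-forcesᵇ {P = _≤ Δ G} split 0 degrees ≤-refl) (∈-map⁺ (deg G) (∈-allFin v))
  where
  degrees : List ℕ
  degrees = map (deg G) (allFin (n G))
  split : ∀ a b → a ⊔ b ≤ Δ G → a ≤ Δ G × b ≤ Δ G
  split a b a⊔b≤Δ = m⊔n≤o⇒m≤o a b a⊔b≤Δ , m⊔n≤o⇒n≤o a b a⊔b≤Δ

Δ-lub : (G : Graph) {k : ℕ} → (∀ v → deg G v ≤ k) → Δ G ≤ k
Δ-lub G {k} deg≤k = foldr-preservesᵇ {P = _≤ k} ⊔-lub z≤n (All.tabulate bounded)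
  where
  bounded : ∀ {d} → d ∈ map (deg G) (allFin (n G)) → d ≤ k
  bounded d∈ with v , _ , refl ← ∈-map⁻ (deg G) d∈ = deg≤k v

Δ-attained : (G : Graph) → 0 < Δ G → ∃[ v ] deg G v ≡ Δ G
Δ-attained G 0<Δ with foldr-selective ⊔-sel 0 (map (deg G) (allFin (n G)))
... | inj₁ Δ≡0 = ⊥-elim (<⇒≢ 0<Δ (sym Δ≡0))
... | inj₂ Δ∈ with v , _ , Δ≡deg ← ∈-map⁻ (deg G) Δ∈ = v , sym Δ≡deg

induced : (G : Graph) {m : ℕ} → (Fin m → Fin (n G)) → Graph
induced G {m} e = record
  { n     = m
  ; adj   = λ a b → adj G (e a) (e b)
  ; sym   = λ a b → adj-sym G (e a) (e b)
  ; irrfl = λ a → irrfl G (e a)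
  }

module _ (G : Graph) {m : ℕ} {e : Fin m → Fin (n G)} (e-injective : Injective _≡_ _≡_ e) where

  induced-planar : Planar G → Planar (induced G e)
  induced-planar (p , p-injective , avoids-edges , crossings) =
    p ∘ e ,
    e-injective ∘ p-injective ,
    (λ w a b ab w≢a w≢b →
      avoids-edges (e w) (e a) (e b) ab (w≢a ∘ e-injective) (w≢b ∘ e-injective)) ,
    λ a b c d ab cd distinct q q∈ab q∈cd →
      reflect (crossings (e a) (e b) (e c) (e d) ab cd (distinct ∘ reflect-edge) q q∈ab q∈cd)
    where
    reflect-edge : ∀ {a b c d} → (e a ≡ e c × e b ≡ e d) ⊎ (e a ≡ e d × e b ≡ e c) →
                   (a ≡ c × b ≡ d) ⊎ (a ≡ d × b ≡ c)
    reflect-edge = Sum.map (Product.map e-injective e-injective)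
                           (Product.map e-injective e-injective)

    reflect : ∀ {a b c d q} → ∃[ w ] ((w ≡ e a ⊎ w ≡ e b) × (w ≡ e c ⊎ w ≡ e d) × q ≡ p w) →
              ∃[ w ] ((w ≡ a ⊎ w ≡ b) × (w ≡ c ⊎ w ≡ d) × q ≡ p (e w))
    reflect {a}     (_ , inj₁ refl , w∈cd , q≡pw) =
      a , inj₁ refl , Sum.map e-injective e-injective w∈cd , q≡pw
    reflect {b = b} (_ , inj₂ refl , w∈cd , q≡pw) =
      b , inj₂ refl , Sum.map e-injective e-injective w∈cd , q≡pw

  induced-girth : GirthAtLeast6 G → GirthAtLeast6 (induced G e)
  induced-girth girth k 2≤k k≤4 (f , f-injective , path , closing) =
    girth k 2≤k k≤4 (e ∘ f , f-injective ∘ e-injective , path , closing)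

_─_ : (G : Graph) → Fin (n G) → Graph
G ─ u = induced G (punchIn′ u)

module _ (G : Graph) (u : Fin (n G)) where

  Δ-─-≤ : Δ (G ─ u) ≤ Δ G
  Δ-─-≤ = Δ-lub (G ─ u) λ a →
    ≤-trans (countᵇ-punchIn′-≤ (adj G (punchIn′ u a)) u) (deg≤Δ G (punchIn′ u a))

  deg-─-punchOut′ : ∀ {w} (u≢w : u ≢ w) → adj G w u ≡ false →
    deg (G ─ u) (punchOut′ u≢w) ≡ deg G w
  deg-─-punchOut′ {w} u≢w w≁u = begin
    deg (G ─ u) (punchOut′ u≢w)
      ≡⟨ cong (λ z → countᵇ (adj G z ∘ punchIn′ u)) (punchIn′-punchOut′ u≢w) ⟩
    countᵇ (adj G w ∘ punchIn′ u)
      ≡⟨ countᵇ-punchIn′-≡ (adj G w) w≁u ⟩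
    deg G w
      ∎
    where open ≡-Reasoning

TwoDistProperOn : (G : Graph) {k : ℕ} → (Fin (n G) → Fin k) → (Fin (n G) → Set) → Set
TwoDistProperOn G c P = ∀ a b → P a → P b → a ≢ b → WithinDist2 G a b → c a ≢ c b

TwoDistColoring-weaken : ∀ G {k k′} → k ≤ k′ → TwoDistColoring G k → TwoDistColoring G k′
TwoDistColoring-weaken G k≤k′ (c , proper) =
  (λ z → inject≤ (c z) k≤k′) ,
  λ a b a≢b dist → proper a b a≢b dist ∘ inject≤-injective k≤k′ k≤k′ (c a) (c b)

module _ (G : Graph) {k : ℕ} where

  TwoDistProperOn-extend : ∀ {c : Fin (n G) → Fin k} {P} a → TwoDistProperOn G c P → ¬ P a →
    (B : List (Fin (n G))) → length B < k → (∀ {b} → P b → WithinDist2 G a b → b ∈ B) →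
    ∃[ c⁺ ] TwoDistProperOn G c⁺ (λ z → z ≡ a ⊎ P z)
  TwoDistProperOn-extend {c} {P} a proper a∉P B |B|<k near = c⁺ , proper⁺
    where
    fresh : ∃[ i ] i ∉ map c B
    fresh = length<⇒∃∉ (map c B) (subst (_< k) (sym (length-map c B)) |B|<k)

    c⁺ : Fin (n G) → Fin k
    c⁺ = updateAt c a (const (proj₁ fresh))

    c⁺-at-a : c⁺ a ≡ proj₁ fresh
    c⁺-at-a = updateAt-updates a c

    c⁺-on-P : ∀ {z} → P z → c⁺ z ≡ c z
    c⁺-on-P {z} pz = updateAt-minimal z a c λ { refl → a∉P pz }

    fresh-near-a : ∀ {b} → P b → WithinDist2 G a b → c⁺ a ≢ c⁺ b
    fresh-near-a {b} pb dist same =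
      proj₂ fresh (subst (_∈ map c B)
                         (trans (sym (c⁺-on-P pb)) (trans (sym same) c⁺-at-a))
                         (∈-map⁺ c (near pb dist)))

    proper⁺ : TwoDistProperOn G c⁺ (λ z → z ≡ a ⊎ P z)
    proper⁺ _ _ (inj₁ refl) (inj₁ refl) a≢a _    = ⊥-elim (a≢a refl)
    proper⁺ _ _ (inj₁ refl) (inj₂ pb)   _   dist = fresh-near-a pb dist
    proper⁺ _ _ (inj₂ pa)   (inj₁ refl) _   dist = fresh-near-a pa (WithinDist2-sym G dist) ∘ sym
    proper⁺ a′ b′ (inj₂ pa) (inj₂ pb)   a≢b dist =
      proper a′ b′ pa pb a≢b dist ∘ λ same → trans (sym (c⁺-on-P pa)) (trans same (c⁺-on-P pb))

module _ (G : Graph) {k : ℕ} {u d : Fin (n G)} (u≢d : u ≢ d) where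

  -- c ∘ collapse u≢d gives u the colour of d; only the vertices of P, which avoid u, matter.
  TwoDistColoring-─⇒TwoDistProperOn : ∀ {P} (c : TwoDistColoring (G ─ u) k) →
    (∀ {z} → P z → u ≢ z) →
    (∀ {a b} → P a → P b → Adjacent G a u → Adjacent G u b → a ≡ b) →
    TwoDistProperOn G (proj₁ c ∘ collapse u≢d) P
  TwoDistColoring-─⇒TwoDistProperOn (c , proper) avoids-u one-neighbour a b pa pb a≢b dist =
    proper (↓ a) (↓ b) (a≢b ∘ ↓-injective) (dist↓ dist)
    where
    ↓ : Fin (n G) → Fin (n (G ─ u))
    ↓ = collapse u≢d

    back : ∀ {z} → u ≢ z → punchIn′ u (↓ z) ≡ z
    back = punchIn′-collapse u≢d

    ↓-injective : ↓ a ≡ ↓ b → a ≡ b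
    ↓-injective same =
      trans (sym (back (avoids-u pa))) (trans (cong (punchIn′ u) same) (back (avoids-u pb)))

    adjacent↓ : ∀ {s t} → u ≢ s → u ≢ t → Adjacent G s t → Adjacent (G ─ u) (↓ s) (↓ t)
    adjacent↓ u≢s u≢t = subst₂ (Adjacent G) (sym (back u≢s)) (sym (back u≢t))

    dist↓ : WithinDist2 G a b → WithinDist2 (G ─ u) (↓ a) (↓ b)
    dist↓ (inj₁ ab) = inj₁ (adjacent↓ (avoids-u pa) (avoids-u pb) ab)
    dist↓ (inj₂ (t , at , tb)) with u ≟ t
    ... | yes refl = ⊥-elim (a≢b (one-neighbour pa pb at tb))
    ... | no u≢t   =
      inj₂ (↓ t , adjacent↓ (avoids-u pa) u≢t at , adjacent↓ u≢t (avoids-u pb) tb)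

few-colours : ∀ (G : Graph) {j} w → j ≤ 3 → j + deg G w < Δ G + 4
few-colours G {j} w j≤3 = begin-strict
  j + deg G w   ≤⟨ +-mono-≤ j≤3 (deg≤Δ G w) ⟩
  3 + Δ G       <⟨ ≤-refl ⟩
  4 + Δ G       ≡⟨ +-comm 4 (Δ G) ⟩
  Δ G + 4       ∎
  where open ≤-Reasoning

module DegreeTwoEdge (G : Graph) {u v : Fin (n G)} (uv : Adjacent G u v)
                     (du : deg G u ≡ 2) (dv : deg G v ≡ 2) where

  private
    x : Fin (n G)
    x = proj₁ (degree-2-neighbours G du uv)

    neighbour-of-u : ∀ {z} → Adjacent G u z → z ≡ v ⊎ z ≡ x
    neighbour-of-u = proj₂ (degree-2-neighbours G du uv)

    y : Fin (n G)
    y = proj₁ (degree-2-neighbours G dv (Adjacent-sym G uv))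

    neighbour-of-v : ∀ {z} → Adjacent G v z → z ≡ u ⊎ z ≡ y
    neighbour-of-v = proj₂ (degree-2-neighbours G dv (Adjacent-sym G uv))

    -- v must be recoloured too: in G ─ u it is no longer within distance 2 of x.
    Others : Fin (n G) → Set
    Others z = u ≢ z × v ≢ z

    Others⁺ : Fin (n G) → Set
    Others⁺ z = z ≡ v ⊎ Others z

    x-only-neighbour : ∀ {a b} → Others a → Others b → Adjacent G a u → Adjacent G u b → a ≡ b
    x-only-neighbour (_ , v≢a) (_ , v≢b) au ub
      with neighbour-of-u (Adjacent-sym G au) | neighbour-of-u ub
    ... | inj₁ refl | _         = ⊥-elim (v≢a refl)
    ... | _         | inj₁ refl = ⊥-elim (v≢b refl)
    ... | inj₂ refl | inj₂ refl = refl

    near-v : ∀ {b} → Others b → WithinDist2 G v b → b ∈ y ∷ x ∷ neighbours G y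
    near-v (u≢b , _) (inj₁ vb) with neighbour-of-v vb
    ... | inj₁ refl = ⊥-elim (u≢b refl)
    ... | inj₂ refl = here refl
    near-v (_ , v≢b) (inj₂ (t , vt , tb)) with neighbour-of-v vt
    ... | inj₂ refl = there (there (∈-neighbours G tb))
    ... | inj₁ refl with neighbour-of-u tb
    ...   | inj₁ refl = ⊥-elim (v≢b refl)
    ...   | inj₂ refl = there (here refl)

    u∉Others⁺ : ¬ Others⁺ u
    u∉Others⁺ (inj₁ u≡v)       = Adjacent⇒≢ G uv u≡v
    u∉Others⁺ (inj₂ (u≢u , _)) = u≢u refl

    near-u : ∀ {b} → Others⁺ b → WithinDist2 G u b → b ∈ v ∷ x ∷ y ∷ neighbours G x
    near-u _ (inj₁ ub) with neighbour-of-u ub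
    ... | inj₁ refl = here refl
    ... | inj₂ refl = there (here refl)
    near-u b∈Others⁺ (inj₂ (t , ut , tb)) with neighbour-of-u ut
    ... | inj₂ refl = there (there (there (∈-neighbours G tb)))
    ... | inj₁ refl with neighbour-of-v tb
    ...   | inj₁ refl = ⊥-elim (u∉Others⁺ b∈Others⁺)
    ...   | inj₂ refl = there (there (here refl))

    covered : ∀ z → z ≡ u ⊎ Others⁺ z
    covered z with u ≟ z | v ≟ z
    ... | yes refl | _        = inj₁ refl
    ... | no _     | yes refl = inj₂ (inj₁ refl)
    ... | no u≢z   | no v≢z   = inj₂ (inj₂ (u≢z , v≢z))

  colouring-extends : TwoDistColoring (G ─ u) (Δ G + 4) → TwoDistColoring G (Δ G + 4)
  colouring-extends c =
    let c₀-proper =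
          TwoDistColoring-─⇒TwoDistProperOn G (Adjacent⇒≢ G uv) c proj₁ x-only-neighbour
        c₁ , c₁-proper = TwoDistProperOn-extend G v c₀-proper (λ (_ , v≢v) → v≢v refl)
                           (y ∷ x ∷ neighbours G y) (few-colours G y (n≤1+n 2)) near-v
        c₂ , c₂-proper = TwoDistProperOn-extend G u c₁-proper u∉Others⁺
                           (v ∷ x ∷ y ∷ neighbours G x) (few-colours G x ≤-refl) near-u
    in c₂ , λ a b a≢b → c₂-proper a b (covered a) (covered b) a≢b

deletion-counterexample : ∀ G → IsCounterexample G → ∀ {u v w} → Adjacent G u v →
  deg G u ≡ 2 → deg G v ≡ 2 → deg G w ≡ Δ G → adj G w u ≡ false → IsCounterexample (G ─ u)
deletion-counterexample G (planar , girth , 6≤Δ , uncolourable) {u} {w = w} uv du dv dw w≁u =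
  induced-planar G (punchIn′-injective u) planar ,
  induced-girth G (punchIn′-injective u) girth ,
  6≤Δ─ ,
  uncolourable ∘ DegreeTwoEdge.colouring-extends G uv du dv
               ∘ TwoDistColoring-weaken (G ─ u) (+-monoˡ-≤ 4 (Δ-─-≤ G u))
  where
  u≢w : u ≢ w
  u≢w refl with subst (6 ≤_) (trans (sym dw) du) 6≤Δ
  ... | s≤s (s≤s ())

  6≤Δ─ : 6 ≤ Δ (G ─ u)
  6≤Δ─ = begin
    6                           ≤⟨ 6≤Δ ⟩
    Δ G                         ≡⟨ dw ⟨
    deg G w                     ≡⟨ deg-─-punchOut′ G u u≢w w≁u ⟨
    deg (G ─ u) (punchOut′ u≢w) ≤⟨ deg≤Δ (G ─ u) (punchOut′ u≢w) ⟩
    Δ (G ─ u)                   ∎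
    where open ≤-Reasoning

maximum-degree-adjacent : ∀ G → MinimalCounterexample G → ∀ {u v w} → Adjacent G u v →
  deg G u ≡ 2 → deg G v ≡ 2 → deg G w ≡ Δ G → Adjacent G w u
maximum-degree-adjacent G (counterexample , minimal) {u} {w = w} uv du dv dw with adj G w u in w~u
... | true  = refl
... | false = ⊥-elim (<⇒≱ (pred[m]<m u) (minimal (G ─ u) G─u-counterexample))
  where
  G─u-counterexample : IsCounterexample (G ─ u)
  G─u-counterexample = deletion-counterexample G counterexample uv du dv dw w~u

proposition2p1 : (G : Graph) → MinimalCounterexample G →
    ¬ (∃[ u ] ∃[ v ] (Adjacent G u v × deg G u ≡ 2 × deg G v ≡ 2))
proposition2p1 G minimal@((_ , girth , 6≤Δ , _) , _) (u , v , uv , du , dv)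
  with w , dw ← Δ-attained G (≤-trans (s≤s z≤n) 6≤Δ) =
  no-triangle G girth uv (Adjacent-sym G w~v) w~u
  where
  w~u : Adjacent G w u
  w~u = maximum-degree-adjacent G minimal uv du dv dw
  w~v : Adjacent G w v
  w~v = maximum-degree-adjacent G minimal (Adjacent-sym G uv) dv du dw
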